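{- For $n\geq 2$, $a_n(132;213) = n-1$.
   Context: $\mathcal{S}_n$ is the set of permutations of $[n]=\{1,\dots,n\}$, written in one-line notation $\pi=\pi_1\pi_2\cdots\pi_n$ with $\pi_i=\pi(i)$. A permutation is cyclic if it consists of exactly one $n$-cycle. For a cyclic $\pi$, its standard cycle notation is $C(\pi)=(c_1,c_2,\dots,c_n)$ with $c_1=1$ and $c_i=\pi_{c_{i-1}}$ for $2\le i\le n$. A sequence of distinct integers $w_1\cdots w_m$ contains a pattern $\sigma\in\mathcal{S}_k$ if there are indices $i_1<\dots<i_k$ with $w_{i_1}\cdots w_{i_k}$ in the same relative order as $\sigma_1\cdots\sigma_k$; otherwise it avoids $\sigma$. For $\sigma,\tau\in\mathcal{S}_3$, $\mathcal{A}_n(\sigma;\tau)$ is the set of cyclic permutations $\pi\in\mathcal{S}_n$ whose one-line notation avoids $\sigma$ and whose cycle notation $C(\pi)$ (as the sequence $c_1c_2\cdots c_n$) avoids $\tau$; $a_n(\sigma;\tau)=|\mathcal{A}_n(\sigma;\tau)|$. -}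

module Defs where

open import Data.Bool using (Bool; true; false; _∧_; _∨_; not; if_then_else_)
open import Data.Nat using (ℕ; zero; suc; _<ᵇ_; _≡ᵇ_)
open import Data.Fin using (Fin; toℕ) renaming (zero to fzero)
open import Data.Bool.ListAction using (all; any)
open import Data.List using (List; []; _∷_; map; allFin; length; filterᵇ; concatMap; lookup)
open import Data.Vec as V using (Vec)
open import Data.Product using (_×_; _,_)

-- Conventions: a permutation of [n] is represented by its one-line notation
-- π = π₁ ⋯ πₙ as a vector of length n with entries in Fin n, i.e. the values
-- 1..n are shifted to 0..n-1 (this does not change relative order, so pattern
-- containment is unaffected; the element 1 of the paper is fzero here).

allWords : (n k : ℕ) → List (Vec (Fin n) k)
allWords n zero = V.[] ∷ []
allWords n (suc k) = concatMap (λ x → map (x V.∷_) (allWords n k)) (allFin n)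

_==_ : {n : ℕ} → Fin n → Fin n → Bool
a == b = toℕ a ≡ᵇ toℕ b

distinct : {A : Set} → (A → A → Bool) → List A → Bool
distinct eq [] = true
distinct eq (x ∷ xs) = all (λ y → not (eq x y)) xs ∧ distinct eq xs

-- the one-line word π is a permutation of Fin n (injective, hence bijective)
isPerm : {n : ℕ} → Vec (Fin n) n → Bool
isPerm π = distinct _==_ (V.toList π)

iter : {n : ℕ} → Vec (Fin n) n → ℕ → Fin n → Fin n
iter π zero x = x
iter π (suc k) x = V.lookup π (iter π k x)

-- cyclic: π consists of exactly one n-cycle, i.e. the orbit of the first
-- element 1 (= fzero) under π is all of [n]: every j equals π^k(1) for some k < n
isCyclic : {n : ℕ} → Vec (Fin n) n → Bool
isCyclic {zero} π = true
isCyclic {suc n} π =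
  all (λ j → any (λ k → iter π (toℕ k) fzero == j) (allFin (suc n))) (allFin (suc n))

cycleNotation : {n : ℕ} → Vec (Fin n) n → List ℕ
cycleNotation {zero} π = []
cycleNotation {suc n} π = map (λ k → toℕ (iter π (toℕ k) fzero)) (allFin (suc n))

oneLine : {n : ℕ} → Vec (Fin n) n → List ℕ
oneLine π = map toℕ (V.toList π)

subseqs : ℕ → List ℕ → List (List ℕ)
subseqs zero xs = [] ∷ []
subseqs (suc k) [] = []
subseqs (suc k) (x ∷ xs) = map (x ∷_) (subseqs k xs) Data.List.++ subseqs (suc k) xs

pairs : List ℕ → List (ℕ × ℕ)
pairs [] = []
pairs (x ∷ xs) = map (x ,_) xs Data.List.++ pairs xs

sameOrder : List ℕ → List ℕ → Bool
sameOrder u s = (length u ≡ᵇ length s) ∧ go (pairs u) (pairs s)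
  where
  go : List (ℕ × ℕ) → List (ℕ × ℕ) → Bool
  go [] [] = true
  go ((a , b) ∷ ps) ((c , d) ∷ qs) =
    (if a <ᵇ b then c <ᵇ d else not (c <ᵇ d)) ∧ go ps qs
  go _ _ = false

contains : List ℕ → List ℕ → Bool
contains σ w = any (λ u → sameOrder u σ) (subseqs (length σ) w)

avoids : List ℕ → List ℕ → Bool
avoids σ w = not (contains σ w)

inA : (σ τ : List ℕ) {n : ℕ} → Vec (Fin n) n → Bool
inA σ τ π = isPerm π ∧ isCyclic π ∧ avoids σ (oneLine π) ∧ avoids τ (cycleNotation π)

a : (σ τ : List ℕ) → ℕ → ℕ
a σ τ n = length (filterᵇ (inA σ τ) (allWords n n))

module Submission where

-- Shift the values to 0 … m, where m = n-1. For each i < m the candidate is the cyclic permutation with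
-- cycle notation 0, m, m-1, …, m+1-i, 1, 2, …, m-i; it avoids 132 and its cycle notation avoids 213.
-- Conversely, let C be the cycle notation and L the one-line notation of a member of 𝒜_n(132;213).
-- Avoiding 213, C increases up to the position of its maximum m. If that position is the last one, C is
-- the identity (i = 0); a 213 in C or a 132 in L excludes every other position except 1. If C 1 = m
-- and the value 1 sits at position i+1, an induction along the cycle, each step closed by a 213 in C or
-- a 132 in L, gives C t = m+1-t for 1 ≤ t ≤ i and C t = t-i afterwards. As the cycle notation determines
-- the permutation, 𝒜_n(132;213) consists of exactly the n-1 candidates.

open import Defs
open import Data.Bool using (Bool; true; false; T; not; _∧_)
open import Data.Bool.ListAction using (and; all; any)
open import Data.Bool.Properties using (T-∧)
open import Data.Empty using (⊥; ⊥-elim)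
open import Data.Fin using (Fin; toℕ; fromℕ<) renaming (zero to fzero; suc to fsuc)
import Data.Fin.Properties as Fin
open import Data.List using (List; []; _∷_; _++_; map; concatMap; filterᵇ; tabulate; allFin; length; cartesianProductWith)
open import Data.List.Properties using (length-tabulate; length-map; map-∘; map-tabulate)
open import Data.List.Membership.Propositional using (_∈_; find; lose)
open import Data.List.Membership.Propositional.Properties using (∈-map⁺; ∈-map⁻; ∈-++⁺ˡ; ∈-++⁺ʳ; ∈-++⁻; ∈-filter⁺; ∈-filter⁻; ∈-tabulate⁺; ∈-tabulate⁻; ∈-cartesianProductWith⁺; ∈-allFin)
open import Data.List.Membership.Propositional.Properties.WithK using (unique∧set⇒bag)
open import Data.List.Relation.Binary.BagAndSetEquality using (∼bag⇒↭)
open import Data.List.Relation.Binary.Permutation.Propositional.Properties using (↭-length)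
import Data.List.Relation.Unary.All as All
open import Data.List.Relation.Unary.All.Properties using (all⁺; all⁻)
open import Data.List.Relation.Unary.Any using (here; there)
open import Data.List.Relation.Unary.Any.Properties using (any⁺; any⁻)
open import Data.List.Relation.Unary.Unique.Propositional using (Unique; []; _∷_)
open import Data.List.Relation.Unary.Unique.Propositional.Properties using (filter⁺; tabulate⁺; cartesianProductWith⁺; allFin⁺)
open import Data.Nat using (ℕ; zero; suc; _+_; _∸_; _≤_; _<_; z≤n; s≤s; s≤s⁻¹; z<s; _<ᵇ_; _≡ᵇ_; _≟_; _≤?_)
open import Data.Nat.Properties
open import Data.Product using (∃; _×_; _,_; proj₁; proj₂)
open import Data.Sum using (_⊎_; inj₁; inj₂)
open import Data.Unit using (tt)
open import Data.Vec as V using (Vec)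
open import Data.Vec.Properties using (∷-injective; length-toList; lookup∘tabulate; tabulate∘lookup; tabulate-cong)
open import Function using (_∘_)
open import Function.Bundles using (_⇔_; mk⇔; Equivalence)
open import Relation.Binary.Definitions using (Tri; tri<; tri≈; tri>)
open import Relation.Binary.PropositionalEquality using (_≡_; _≢_; refl; sym; trans; cong; cong₂; subst; subst₂; module ≡-Reasoning)
open import Relation.Nullary using (¬_; yes; no)
open import Relation.Nullary.Decidable using (T?)
open import Relation.Nullary.Reflects using (ofʸ; ofⁿ)

n≢0∧n≢1⇒1<n : ∀ {n} → n ≢ 0 → n ≢ 1 → 1 < n
n≢0∧n≢1⇒1<n {zero} n≢0 _ = ⊥-elim (n≢0 refl)
n≢0∧n≢1⇒1<n {suc zero} _ n≢1 = ⊥-elim (n≢1 refl)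
n≢0∧n≢1⇒1<n {suc (suc n)} _ _ = s≤s (s≤s z≤n)

increasing-self-map-id : {m : ℕ} (f : ℕ → ℕ) → (∀ {t} → t < m → f t < f (suc t)) → f m ≤ m →
  ∀ {t} → t ≤ m → f t ≡ t
increasing-self-map-id {m} f increasing fm≤m {t} t≤m = ≤-antisym below above
  where
  lower : ∀ {s} → s ≤ m → s ≤ f s
  lower {zero} _ = z≤n
  lower {suc s} s<m = ≤-<-trans (lower (<⇒≤ s<m)) (increasing s<m)
  spread : ∀ k {s} → s + k ≤ m → f s + k ≤ f (s + k)
  spread zero {s} _ rewrite +-identityʳ s | +-identityʳ (f s) = ≤-refl
  spread (suc k) {s} s+k<m rewrite +-suc s k | +-suc (f s) k =
    ≤-<-trans (spread k (<⇒≤ s+k<m)) (increasing s+k<m)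
  above : t ≤ f t
  above = lower t≤m
  below : f t ≤ t
  below = +-cancelʳ-≤ (m ∸ t) (f t) t (begin
    f t + (m ∸ t)   ≤⟨ spread (m ∸ t) (≤-reflexive t+[m∸t]≡m) ⟩
    f (t + (m ∸ t)) ≡⟨ cong f t+[m∸t]≡m ⟩
    f m             ≤⟨ fm≤m ⟩
    m               ≡⟨ sym t+[m∸t]≡m ⟩
    t + (m ∸ t)     ∎)
    where
    open ≤-Reasoning
    t+[m∸t]≡m : t + (m ∸ t) ≡ m
    t+[m∸t]≡m = m+[n∸m]≡n t≤m

extend-≤ : {P : ℕ → Set} {s : ℕ} → (∀ {t} → t ≤ s → P t) → P (suc s) → ∀ {t} → t ≤ suc s → P t
extend-≤ below at t≤s+1 with m≤n⇒m<n∨m≡n t≤s+1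
... | inj₁ t<s+1 = below (s≤s⁻¹ t<s+1)
... | inj₂ refl = at

Injective≤ : ℕ → (ℕ → ℕ) → Set
Injective≤ m f = ∀ {p q} → p ≤ m → q ≤ m → f p ≡ f q → p ≡ q

<-distinct⇒injective : ∀ {m} {f : ℕ → ℕ} → (∀ {a b} → a < b → b ≤ m → f a ≢ f b) → Injective≤ m f
<-distinct⇒injective distinct {a} {b} a≤m b≤m fa≡fb with <-cmp a b
... | tri< a<b _ _ = ⊥-elim (distinct a<b b≤m fa≡fb)
... | tri≈ _ a≡b _ = a≡b
... | tri> _ _ b<a = ⊥-elim (distinct b<a a≤m (sym fa≡fb))

T-not : ∀ {b} → T (not b) ⇔ (¬ T b)
T-not {false} = mk⇔ (λ _ ()) (λ _ → tt)
T-not {true} = mk⇔ (λ ()) (λ ¬true → ¬true tt)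

length-filterᵇ-enumerated : {A : Set} {m : ℕ} (p : A → Bool) {xs : List A} → Unique xs → (∀ x → x ∈ xs) →
  (f : Fin m → A) → (∀ {i j} → f i ≡ f j → i ≡ j) →
  (∀ x → T (p x) → ∃ λ i → x ≡ f i) → (∀ i → T (p (f i))) →
  length (filterᵇ p xs) ≡ m
length-filterᵇ-enumerated p {xs} unique-xs complete f f-injective only-f all-f =
  trans (↭-length (∼bag⇒↭ (unique∧set⇒bag (filter⁺ (T? ∘ p) unique-xs) (tabulate⁺ f-injective)
                                            same-members)))
        (length-tabulate f)
  where
  same-members : ∀ {x} → (x ∈ filterᵇ p xs) ⇔ (x ∈ tabulate f)
  same-members {x} = mk⇔ to from
    where
    to : x ∈ filterᵇ p xs → x ∈ tabulate f
    to x∈ with i , refl ← only-f x (proj₂ (∈-filter⁻ (T? ∘ p) {xs = xs} x∈)) = ∈-tabulate⁺ i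
    from : x ∈ tabulate f → x ∈ filterᵇ p xs
    from x∈ with i , refl ← ∈-tabulate⁻ x∈ = ∈-filter⁺ (T? ∘ p) (complete (f i)) (all-f i)

-- Cyclic permutations of {0, …, m} in index form

Avoids-132 : ℕ → (ℕ → ℕ) → Set
Avoids-132 m f = ∀ {p q r} → p < q → q < r → r ≤ m → f p < f r → f r < f q → ⊥

Avoids-213 : ℕ → (ℕ → ℕ) → Set
Avoids-213 m f = ∀ {a b c} → a < b → b < c → c ≤ m → f b < f a → f a < f c → ⊥

-- L is a cyclic permutation of {0, …, m} in one-line notation and C its cycle notation, both read as
-- functions on the positions 0 … m.
record Cyclic (m : ℕ) (L C : ℕ → ℕ) : Set where
  field
    L-bounded    : ∀ {p} → p ≤ m → L p ≤ m
    L-injective  : Injective≤ m L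
    C-zero       : C 0 ≡ 0
    C-suc        : ∀ {t} → t < m → C (suc t) ≡ L (C t)
    C-surjective : ∀ {v} → v ≤ m → ∃ λ t → t ≤ m × C t ≡ v

-- Membership of L in 𝒜_{m+1}(132;213).
record Admissible (m : ℕ) (L C : ℕ → ℕ) : Set where
  field
    cyclic       : Cyclic m L C
    L-avoids-132 : Avoids-132 m L
    C-avoids-213 : Avoids-213 m C

-- c is entry t of the cycle notation 0, m, m-1, …, m+1-i, 1, 2, …, m-i.
data CycleEntry (m i : ℕ) : ℕ → ℕ → Set where
  origin     : CycleEntry m i 0 0
  descending : ∀ {t c} → 1 ≤ t → t ≤ i → c + t ≡ suc m → CycleEntry m i t c
  ascending  : ∀ {t c} → i < t → c + i ≡ t → CycleEntry m i t c

module CyclicProperties {m : ℕ} {L C : ℕ → ℕ} (cyclic : Cyclic m L C) where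
  open Cyclic cyclic

  C-bounded : ∀ {t} → t ≤ m → C t ≤ m
  C-bounded {zero} _ = subst (_≤ m) (sym C-zero) z≤n
  C-bounded {suc t} t<m = subst (_≤ m) (sym (C-suc t<m)) (L-bounded (C-bounded (<⇒≤ t<m)))

  C-unshift : ∀ a {d} → a + d ≤ m → C a ≡ C (a + d) → C 0 ≡ C d
  C-unshift zero _ eq = eq
  C-unshift (suc a) {d} a+d<m eq = C-unshift a (<⇒≤ a+d<m)
    (L-injective (C-bounded (<⇒≤ a<m)) (C-bounded (<⇒≤ a+d<m))
      (trans (sym (C-suc a<m)) (trans eq (C-suc a+d<m))))
    where
    a<m : a < m
    a<m = ≤-<-trans (m≤m+n a d) a+d<m

  C-periodic : ∀ {d} → 0 < d → d ≤ m → C 0 ≡ C d → ∀ {t} → t ≤ m → ∃ λ s → s < d × C t ≡ C s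
  C-periodic 0<d _ _ {zero} _ = 0 , 0<d , refl
  C-periodic {d} 0<d d≤m C0≡Cd {suc t} t<m with C-periodic 0<d d≤m C0≡Cd (<⇒≤ t<m)
  ... | s , s<d , Ct≡Cs with m≤n⇒m<n∨m≡n s<d
  ...   | inj₁ s+1<d = suc s , s+1<d , trans (C-suc t<m) (trans (cong L Ct≡Cs) (sym (C-suc (<-≤-trans s<d d≤m))))
  ...   | inj₂ refl = 0 , 0<d , trans (C-suc t<m) (trans (cong L Ct≡Cs) (trans (sym (C-suc d≤m)) (sym C0≡Cd)))

  -- A repetition makes C periodic with a period d ≤ m, so C could take at most d of the m+1 values.
  C-repeat-free : ∀ {a b} → a < b → b ≤ m → C a ≢ C b
  C-repeat-free {a} a<b b≤m Ca≡Cb with d , refl ← m≤n⇒∃[o]m+o≡n (<⇒≤ a<b) =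
    <⇒≱ (s≤s d≤m) (Fin.injective⇒≤ representative-injective)
    where
    0<d : 0 < d
    0<d = +-cancelˡ-< a 0 d (subst (_< a + d) (sym (+-identityʳ a)) a<b)
    d≤m : d ≤ m
    d≤m = ≤-trans (m≤n+m d a) b≤m
    period : C 0 ≡ C d
    period = C-unshift a b≤m Ca≡Cb
    preimage : (v : Fin (suc m)) → ∃ λ (s : Fin d) → C (toℕ s) ≡ toℕ v
    preimage v with t , t≤m , Ct≡v ← C-surjective (Fin.toℕ≤pred[n] v)
               with s , s<d , Ct≡Cs ← C-periodic 0<d d≤m period t≤m =
      fromℕ< s<d , trans (cong C (Fin.toℕ-fromℕ< s<d)) (trans (sym Ct≡Cs) Ct≡v)
    representative-injective : ∀ {v w} → proj₁ (preimage v) ≡ proj₁ (preimage w) → v ≡ w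
    representative-injective {v} {w} eq = Fin.toℕ-injective
      (trans (sym (proj₂ (preimage v))) (trans (cong (C ∘ toℕ) eq) (proj₂ (preimage w))))

  C-injective : Injective≤ m C
  C-injective = <-distinct⇒injective C-repeat-free

  C-positive : ∀ {t} → 1 ≤ t → t ≤ m → 0 < C t
  C-positive 1≤t t≤m =
    n≢0⇒n>0 λ Ct≡0 → <⇒≢ 1≤t (sym (C-injective t≤m z≤n (trans Ct≡0 (sym C-zero))))

  position-positive : ∀ {j} → 0 < C j → 1 ≤ j
  position-positive {zero} 0<C0 = ⊥-elim (<-irrefl (sym C-zero) 0<C0)
  position-positive {suc j} _ = s≤s z≤n

  L-zero : 0 < m → L 0 ≡ C 1
  L-zero 0<m = trans (cong L (sym C-zero)) (sym (C-suc 0<m))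

  L-C-last : L (C m) ≡ 0
  L-C-last with C-surjective (L-bounded (C-bounded (≤-refl {m})))
  ... | zero , _ , C0≡ = trans (sym C0≡) C-zero
  ... | suc s , s<m , Cs+1≡ = ⊥-elim (<-irrefl s≡m s<m)
    where
    s≡m : s ≡ m
    s≡m = C-injective (<⇒≤ s<m) ≤-refl
      (L-injective (C-bounded (<⇒≤ s<m)) (C-bounded ≤-refl) (trans (sym (C-suc s<m)) Cs+1≡))


-- Sufficiency: the candidates

-- How the i-th candidate moves a value c ≥ 1, decided by c + i: up the ascending run, from its top
-- back to 0, from the bottom of the descending run to 1, or down the descending run.
data Step (m i : ℕ) : ℕ → ℕ → Set where
  rising  : ∀ {c} → c + i < m → Step m i c (suc c)
  wrap    : ∀ {c} → c + i ≡ m → Step m i c 0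
  turn    : ∀ {c} → c + i ≡ suc m → Step m i c 1
  falling : ∀ {c} → suc m < suc c + i → Step m i (suc c) c

classify : ∀ m i c → ∃ (Step m i (suc c))
classify m i c with <-cmp (suc c + i) m
... | tri< lt _ _ = _ , rising lt
... | tri≈ _ eq _ = _ , wrap eq
... | tri> _ _ gt with suc c + i ≟ suc m
...   | yes eq = _ , turn eq
...   | no ne = _ , falling (≤∧≢⇒< gt (ne ∘ sym))

next : (m i c : ℕ) → ℕ
next m i (suc c) = proj₁ (classify m i c)
next m zero zero = 1
next m (suc i) zero = m

step : ∀ m i c → Step m i (suc c) (next m i (suc c))
step m i c = proj₂ (classify m i c)

next-rising : ∀ {m i c} → 1 ≤ c → c + i < m → next m i c ≡ suc c
next-rising {m} {i} {suc c} _ lt with next m i (suc c) | step m i c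
... | _ | rising _ = refl
... | _ | wrap eq = ⊥-elim (<-irrefl eq lt)
... | _ | turn eq = ⊥-elim (<-asym lt (subst (m <_) (sym eq) (n<1+n m)))
... | _ | falling gt = ⊥-elim (<-asym lt (<-trans (n<1+n m) gt))

next-wrap : ∀ {m i c} → 1 ≤ c → c + i ≡ m → next m i c ≡ 0
next-wrap {m} {i} {suc c} _ eq with next m i (suc c) | step m i c
... | _ | rising lt = ⊥-elim (<-irrefl eq lt)
... | _ | wrap _ = refl
... | _ | turn eq′ = ⊥-elim (<-irrefl (trans (sym eq) eq′) (n<1+n m))
... | _ | falling gt = ⊥-elim (<-asym (n<1+n m) (subst (suc m <_) eq gt))

next-turn : ∀ {m i c} → 1 ≤ c → c + i ≡ suc m → next m i c ≡ 1
next-turn {m} {i} {suc c} _ eq with next m i (suc c) | step m i c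
... | _ | rising lt = ⊥-elim (<-asym lt (subst (m <_) (sym eq) (n<1+n m)))
... | _ | wrap eq′ = ⊥-elim (<-irrefl (trans (sym eq′) eq) (n<1+n m))
... | _ | turn _ = refl
... | _ | falling gt = ⊥-elim (<-irrefl (sym eq) gt)

next-falling : ∀ {m i c} → suc m < suc c + i → next m i (suc c) ≡ c
next-falling {m} {i} {c} gt with next m i (suc c) | step m i c
... | _ | rising lt = ⊥-elim (<-asym lt (<-trans (n<1+n m) gt))
... | _ | wrap eq = ⊥-elim (<-asym (n<1+n m) (subst (suc m <_) eq gt))
... | _ | turn eq = ⊥-elim (<-irrefl (sym eq) gt)
... | _ | falling _ = refl

next-zero-positive : ∀ {m i} → 0 < m → 0 < next m i 0
next-zero-positive {m} {zero} _ = z<s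
next-zero-positive {m} {suc i} 0<m = 0<m

first-entry : ∀ {m i} → i < m → CycleEntry m i 1 (next m i 0)
first-entry {m} {zero} _ = ascending z<s refl
first-entry {m} {suc i} _ = descending ≤-refl (s≤s z≤n) (+-comm m 1)

next-≤-suc : ∀ {m i c} → 1 ≤ c → next m i c ≤ suc c
next-≤-suc {m} {i} {suc c} _ with next m i (suc c) | step m i c
... | _ | rising _ = ≤-refl
... | _ | wrap _ = z≤n
... | _ | turn _ = s≤s z≤n
... | _ | falling _ = ≤-trans (n≤1+n c) (n≤1+n (suc c))

rising-if-above : ∀ {m i c} → 1 ≤ c → c < next m i c → c + i < m
rising-if-above {m} {i} {suc c} _ c<v with next m i (suc c) | step m i c
... | _ | rising c+i<m = c+i<m
... | _ | wrap _ = ⊥-elim (n≮0 c<v)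
... | _ | turn _ = ⊥-elim (n≮0 (s≤s⁻¹ c<v))
... | _ | falling _ = ⊥-elim (<⇒≱ c<v (n≤1+n c))

next≡0⇒wrap : ∀ {m i c} → i < m → next m i c ≡ 0 → c + i ≡ m
next≡0⇒wrap {m} {i} {zero} i<m v≡0 =
  ⊥-elim (<⇒≢ (next-zero-positive {i = i} (≤-<-trans z≤n i<m)) (sym v≡0))
next≡0⇒wrap {m} {i} {suc c} i<m v≡0 with next m i (suc c) | step m i c
... | _ | rising _ = ⊥-elim (1+n≢0 v≡0)
... | _ | wrap c+i≡m = c+i≡m
... | _ | turn _ = ⊥-elim (1+n≢0 v≡0)
... | _ | falling gt = ⊥-elim (<-asym i<m (s≤s⁻¹ (subst (λ c → suc m < suc c + i) v≡0 gt)))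

next≡1⇒turn : ∀ {m i c} → i < m → 1 ≤ c → next m i c ≡ 1 → c + i ≡ suc m
next≡1⇒turn {m} {i} {suc c} i<m _ v≡1 with next m i (suc c) | step m i c
... | _ | rising _ = ⊥-elim (1+n≢0 (suc-injective v≡1))
... | _ | wrap _ = ⊥-elim (0≢1+n v≡1)
... | _ | turn c+i≡ = c+i≡
... | _ | falling gt = ⊥-elim (<⇒≱ i<m (s≤s⁻¹ (s≤s⁻¹ (subst (λ c → suc m < suc c + i) v≡1 gt))))

descent-lands-low : ∀ {m i q r} → 1 ≤ q → q < r → next m i r < next m i q → next m i r ≤ 1
descent-lands-low {m} {i} {q} {suc r} 1≤q q<r drop with next m i (suc r) | step m i r
... | _ | wrap _ = z≤n
... | _ | turn _ = ≤-refl
... | _ | rising _ = ⊥-elim (<⇒≱ drop (≤-trans (next-≤-suc 1≤q) (≤-trans q<r (n≤1+n (suc r)))))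
... | _ | falling gt = ⊥-elim (<-asym gt (≤-<-trans
      (≤-trans (+-monoˡ-≤ i (s≤s r≤q)) (rising-if-above 1≤q (≤-<-trans (s≤s⁻¹ q<r) drop))) (n<1+n m)))
  where
  r≤q : r ≤ q
  r≤q = s≤s⁻¹ (<-≤-trans drop (next-≤-suc 1≤q))

module Candidate {m i : ℕ} (i<m : i < m) where

  entry-bounded : ∀ {t c} → t ≤ m → CycleEntry m i t c → c ≤ m
  entry-bounded _ origin = z≤n
  entry-bounded _ (descending {c = c} 1≤t _ c+t≡) = s≤s⁻¹ (subst (suc c ≤_) c+t≡ (m<m+n c 1≤t))
  entry-bounded t≤m (ascending {c = c} _ c+i≡t) = ≤-trans (m≤m+n c i) (subst (_≤ m) (sym c+i≡t) t≤m)

  entry-functional : ∀ {t c c′} → CycleEntry m i t c → CycleEntry m i t c′ → c ≡ c′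
  entry-functional origin origin = refl
  entry-functional origin (descending () _ _)
  entry-functional origin (ascending () _)
  entry-functional (descending () _ _) origin
  entry-functional (ascending () _) origin
  entry-functional (descending {t} _ _ e) (descending _ _ e′) = +-cancelʳ-≡ t _ _ (trans e (sym e′))
  entry-functional (ascending _ e) (ascending _ e′) = +-cancelʳ-≡ i _ _ (trans e (sym e′))
  entry-functional (descending _ t≤i _) (ascending i<t _) = ⊥-elim (<⇒≱ i<t t≤i)
  entry-functional (ascending i<t _) (descending _ t≤i _) = ⊥-elim (<⇒≱ i<t t≤i)

  ascending-below-descending : ∀ {t c t′ c′} →
    t ≤ i → c + t ≡ suc m → c′ + i ≡ t′ → t′ ≤ m → c′ < c
  ascending-below-descending {t} {c} {t′} {c′} t≤i c+t≡ c′+i≡ t′≤m = +-cancelʳ-< i c′ c (begin-strict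
    c′ + i  ≡⟨ c′+i≡ ⟩
    t′      ≤⟨ t′≤m ⟩
    m       <⟨ n<1+n m ⟩
    suc m   ≡⟨ sym c+t≡ ⟩
    c + t   ≤⟨ +-monoʳ-≤ c t≤i ⟩
    c + i   ∎)
    where open ≤-Reasoning

  entry-injective : ∀ {t t′ c} → t ≤ m → t′ ≤ m → CycleEntry m i t c → CycleEntry m i t′ c → t ≡ t′
  entry-injective _ _ origin origin = refl
  entry-injective _ t′≤m origin (descending _ _ e) = ⊥-elim (1+n≰n (subst (_≤ m) e t′≤m))
  entry-injective _ _ origin (ascending i<t′ e) = ⊥-elim (<-irrefl e i<t′)
  entry-injective t≤m _ (descending _ _ e) origin = ⊥-elim (1+n≰n (subst (_≤ m) e t≤m))
  entry-injective _ _ (ascending i<t e) origin = ⊥-elim (<-irrefl e i<t)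
  entry-injective _ _ (descending {c = c} _ _ e) (descending _ _ e′) = +-cancelˡ-≡ c _ _ (trans e (sym e′))
  entry-injective _ _ (ascending _ e) (ascending _ e′) = trans (sym e) e′
  entry-injective _ t′≤m (descending _ t≤i e) (ascending _ e′) =
    ⊥-elim (<-irrefl refl (ascending-below-descending t≤i e e′ t′≤m))
  entry-injective t≤m _ (ascending _ e′) (descending _ t′≤i e) =
    ⊥-elim (<-irrefl refl (ascending-below-descending t′≤i e e′ t≤m))

  entry-surjective : ∀ {c} → c ≤ m → ∃ λ t → t ≤ m × CycleEntry m i t c
  entry-surjective {zero} _ = 0 , z≤n , origin
  entry-surjective {suc c} c<m with suc c + i ≤? m
  ... | yes c+i≤m = suc c + i , c+i≤m , ascending (s≤s (m≤n+m i c)) refl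
  ... | no c+i≰m = m ∸ c , ≤-trans t≤i (<⇒≤ i<m) , descending (m<n⇒0<n∸m c<m) t≤i c+t≡
    where
    c+t≡ : suc c + (m ∸ c) ≡ suc m
    c+t≡ = m+[n∸m]≡n (s≤s (<⇒≤ c<m))
    t≤i : m ∸ c ≤ i
    t≤i = +-cancelˡ-≤ (suc c) (m ∸ c) i (subst (_≤ suc c + i) (sym c+t≡) (≰⇒> c+i≰m))

  next-entry : ∀ {t c} → t < m → CycleEntry m i t c → CycleEntry m i (suc t) (next m i c)
  next-entry _ origin = first-entry i<m
  next-entry t<m (descending {c = zero} _ t≤i e) =
    ⊥-elim (<⇒≱ (≤-<-trans t≤i i<m) (≤-trans (n≤1+n m) (≤-reflexive (sym e))))
  next-entry _ (descending {t} {suc d} 1≤t t≤i c+t≡) with m≤n⇒m<n∨m≡n t≤i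
  ... | inj₁ t<i =
    subst (CycleEntry m i (suc t)) (sym (next-falling (subst (_< suc d + i) c+t≡ (+-monoʳ-< (suc d) t<i))))
      (descending (s≤s z≤n) t<i (trans (+-suc d t) c+t≡))
  ... | inj₂ refl = subst (CycleEntry m i (suc t)) (sym (next-turn (s≤s z≤n) c+t≡)) (ascending (n<1+n t) refl)
  next-entry _ (ascending {c = zero} i<t e) = ⊥-elim (<-irrefl e i<t)
  next-entry t<m (ascending {t} {suc c} i<t c+i≡t) =
    subst (CycleEntry m i (suc t)) (sym (next-rising (s≤s z≤n) (subst (_< m) (sym c+i≡t) t<m)))
      (ascending (<-trans i<t (n<1+n t)) (cong suc c+i≡t))

  final-entry : ∀ {t c} → t ≡ m → CycleEntry m i t c → c + i ≡ m
  final-entry 0≡m origin = ⊥-elim (n≮0 (subst (i <_) (sym 0≡m) i<m))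
  final-entry refl (descending _ m≤i _) = ⊥-elim (<⇒≱ i<m m≤i)
  final-entry refl (ascending _ c+i≡m) = c+i≡m

  last-entry : ∀ {t c} → t ≡ m → CycleEntry m i t c → next m i c ≡ 0
  last-entry {c = c} t≡m entry = next-wrap (n≢0⇒n>0 λ c≡0 → <-irrefl (trans (cong (_+ i) (sym c≡0)) c+i≡m) i<m) c+i≡m
    where
    c+i≡m : c + i ≡ m
    c+i≡m = final-entry t≡m entry

  next-bounded : ∀ {c} → c ≤ m → next m i c ≤ m
  next-bounded c≤m with entry-surjective c≤m
  ... | t , t≤m , entry with m≤n⇒m<n∨m≡n t≤m
  ...   | inj₁ t<m = entry-bounded t<m (next-entry t<m entry)
  ...   | inj₂ t≡m = subst (_≤ m) (sym (last-entry t≡m entry)) z≤n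

  next-injective : ∀ {c c′} → c ≤ m → c′ ≤ m → next m i c ≡ next m i c′ → c ≡ c′
  next-injective c≤m c′≤m eq with entry-surjective c≤m | entry-surjective c′≤m
  ... | t , t≤m , e | t′ , t′≤m , e′ with m≤n⇒m<n∨m≡n t≤m | m≤n⇒m<n∨m≡n t′≤m
  ... | inj₁ t<m | inj₁ t′<m = entry-functional e (subst (λ s → CycleEntry m i s _) (sym t≡t′) e′)
    where
    t≡t′ : t ≡ t′
    t≡t′ = suc-injective (entry-injective t<m t′<m (next-entry t<m e)
             (subst (CycleEntry m i (suc t′)) (sym eq) (next-entry t′<m e′)))
  ... | inj₁ t<m | inj₂ t′≡m = ⊥-elim (1+n≢0 (entry-injective t<m z≤n
          (subst (CycleEntry m i (suc t)) (trans eq (last-entry t′≡m e′)) (next-entry t<m e)) origin))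
  ... | inj₂ t≡m | inj₁ t′<m = ⊥-elim (1+n≢0 (entry-injective t′<m z≤n
          (subst (CycleEntry m i (suc t′)) (trans (sym eq) (last-entry t≡m e)) (next-entry t′<m e′)) origin))
  ... | inj₂ t≡m | inj₂ t′≡m =
    entry-functional e (subst (λ s → CycleEntry m i s _) (trans t′≡m (sym t≡m)) e′)

  entries-avoid-213 : ∀ {a b c ca cb cc} → a < b → b < c → c ≤ m →
    CycleEntry m i a ca → CycleEntry m i b cb → CycleEntry m i c cc → cb < ca → ca < cc → ⊥
  entries-avoid-213 _ _ _ origin _ _ () _
  entries-avoid-213 _ b<c _ _ _ origin _ _ = n≮0 b<c
  entries-avoid-213 {a = a} {ca = ca} {cc = cc} a<b b<c _ (descending _ _ ea) _ (descending _ _ ec) _ ca<cc =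
    <-asym ca<cc (+-cancelʳ-< a cc ca (subst (cc + a <_) (trans ec (sym ea)) (+-monoʳ-< cc (<-trans a<b b<c))))
  entries-avoid-213 _ _ c≤m (descending _ a≤i ea) _ (ascending _ ec) _ ca<cc =
    <-asym ca<cc (ascending-below-descending a≤i ea ec c≤m)
  entries-avoid-213 a<b _ _ (ascending _ _) origin _ _ _ = n≮0 a<b
  entries-avoid-213 a<b _ _ (ascending i<a _) (descending _ b≤i _) _ _ _ = <⇒≱ (<-trans i<a a<b) b≤i
  entries-avoid-213 {ca = ca} {cb} a<b _ _ (ascending _ ea) (ascending _ eb) _ cb<ca _ =
    <-asym cb<ca (+-cancelʳ-< i ca cb (subst₂ _<_ (sym ea) (sym eb) a<b))

  next-avoids-132 : Avoids-132 m (next m i)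
  next-avoids-132 {p} {q} {r} p<q q<r _ Lp<Lr Lr<Lq = <⇒≱ p<q (s≤s⁻¹ (subst (q <_) r≡p+1 q<r))
    where
    1≤q : 1 ≤ q
    1≤q = ≤-<-trans z≤n p<q
    Lr≤1 : next m i r ≤ 1
    Lr≤1 = descent-lands-low 1≤q q<r Lr<Lq
    p+i≡m : p + i ≡ m
    p+i≡m = next≡0⇒wrap i<m (n<1⇒n≡0 (<-≤-trans Lp<Lr Lr≤1))
    r+i≡m+1 : r + i ≡ suc m
    r+i≡m+1 = next≡1⇒turn i<m (<-trans 1≤q q<r) (≤-antisym Lr≤1 (≤-trans (s≤s z≤n) Lp<Lr))
    r≡p+1 : r ≡ suc p
    r≡p+1 = +-cancelʳ-≡ i r (suc p) (trans r+i≡m+1 (cong suc (sym p+i≡m)))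

-- Necessity: the shape of the cycle notation

module Necessity {m : ℕ} {L C : ℕ → ℕ} (A : Admissible m L C) where
  open Admissible A
  open Cyclic cyclic
  open CyclicProperties cyclic

  C-rises-between : ∀ {a b c} → a < b → b < c → c ≤ m → C a < C c → C a < C b
  C-rises-between a<b b<c c≤m Ca<Cc =
    ≤∧≢⇒< (≮⇒≥ λ Cb<Ca → C-avoids-213 a<b b<c c≤m Cb<Ca Ca<Cc)
          (C-repeat-free a<b (<⇒≤ (<-≤-trans b<c c≤m)))

  C-falls-after : ∀ {a b c} → a < b → b < c → c ≤ m → C b < C a → C c < C a
  C-falls-after a<b b<c c≤m Cb<Ca =
    ≤∧≢⇒< (≮⇒≥ (C-avoids-213 a<b b<c c≤m Cb<Ca)) (C-repeat-free (<-trans a<b b<c) c≤m ∘ sym)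

  C-below-max : ∀ {a j} → a ≤ m → j ≤ m → a ≢ j → C j ≡ m → C a < m
  C-below-max a≤m j≤m a≢j Cj≡m =
    ≤∧≢⇒< (C-bounded a≤m) (λ Ca≡m → a≢j (C-injective a≤m j≤m (trans Ca≡m (sym Cj≡m))))

  C-before-max : ∀ {a j} → a < j → j ≤ m → C j ≡ m → C a < C j
  C-before-max a<j j≤m Cj≡m =
    subst (_ <_) (sym Cj≡m) (C-below-max (<⇒≤ (<-≤-trans a<j j≤m)) j≤m (<⇒≢ a<j) Cj≡m)

  rises-to-max : ∀ {a b j} → a < b → b ≤ j → j ≤ m → C j ≡ m → C a < C b
  rises-to-max a<b b≤j j≤m Cj≡m with m≤n⇒m<n∨m≡n b≤j
  ... | inj₁ b<j = C-rises-between a<b b<j j≤m (C-before-max (<-trans a<b b<j) j≤m Cj≡m)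
  ... | inj₂ refl = C-before-max a<b j≤m Cj≡m

  rotation : C m ≡ m → ∀ {t} → t ≤ m → C t ≡ t
  rotation Cm≡m = increasing-self-map-id C (λ t<m → rises-to-max (n<1+n _) t<m ≤-refl Cm≡m) (≤-reflexive Cm≡m)

  -- With μ = C 1 and u = C (j+2) = L m: if μ < u then μ, m, u is a 132 at positions 0 < C j < m;
  -- if u < μ then either C 1, C (j+2), C m is a 213 or 0, C 2, u is a 132 at positions C m < μ < m.
  max-not-interior : ∀ {j} → 1 ≤ j → suc j < m → C (suc j) ≡ m → ⊥
  max-not-interior {j} 1≤j j+1<m Cj+1≡m = compare-with-μ (<-cmp u μ)
    where
    μ u : ℕ
    μ = C 1
    u = C (suc (suc j))
    j<m : j < m
    j<m = <-trans (n<1+n j) j+1<m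
    1<m : 1 < m
    1<m = ≤-<-trans 1≤j j<m
    Lm≡u : L m ≡ u
    Lm≡u = trans (cong L (sym Cj+1≡m)) (sym (C-suc j+1<m))
    μ<C2 : μ < C 2
    μ<C2 = rises-to-max (n<1+n 1) (s≤s 1≤j) (<⇒≤ j+1<m) Cj+1≡m
    μ<m : μ < m
    μ<m = <-≤-trans μ<C2 (C-bounded (<-trans (s≤s 1≤j) j+1<m))
    u<m : u < m
    u<m = C-below-max j+1<m (<⇒≤ j+1<m) (>⇒≢ (n<1+n (suc j))) Cj+1≡m
    above-μ : μ < u → ⊥
    above-μ μ<u = L-avoids-132
      (C-positive 1≤j (<⇒≤ j<m)) (C-below-max (<⇒≤ j<m) (<⇒≤ j+1<m) (<⇒≢ (n<1+n j)) Cj+1≡m) ≤-refl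
      (subst₂ _<_ (sym (L-zero (<-trans z<s 1<m))) (sym Lm≡u) μ<u)
      (subst₂ _<_ (sym Lm≡u) (trans (sym Cj+1≡m) (C-suc j<m)) u<m)
    below-μ : u < μ → Tri (C m < μ) (C m ≡ μ) (μ < C m) → ⊥
    below-μ u<μ (tri< v<μ _ _) = L-avoids-132 v<μ μ<m ≤-refl
      (subst₂ _<_ (sym L-C-last) (sym Lm≡u) (C-positive (s≤s z≤n) j+1<m))
      (subst₂ _<_ (sym Lm≡u) (C-suc 1<m) (<-trans u<μ μ<C2))
    below-μ u<μ (tri≈ _ v≡μ _) = C-repeat-free 1<m ≤-refl (sym v≡μ)
    below-μ u<μ (tri> _ _ μ<v) with m≤n⇒m<n∨m≡n j+1<m
    ... | inj₁ j+2<m = C-avoids-213 (s≤s (s≤s z≤n)) j+2<m ≤-refl u<μ μ<v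
    ... | inj₂ refl = <-asym u<μ μ<v
    compare-with-μ : Tri (u < μ) (u ≡ μ) (μ < u) → ⊥
    compare-with-μ (tri< u<μ _ _) = below-μ u<μ (<-cmp (C m) μ)
    compare-with-μ (tri≈ _ u≡μ _) = C-repeat-free (s≤s (s≤s z≤n)) j+1<m (sym u≡μ)
    compare-with-μ (tri> _ _ μ<u) = above-μ μ<u

  module DescentThenAscent {i : ℕ} (1≤i : 1 ≤ i) (i<m : i < m) (C1≡m : C 1 ≡ m) (Cℓ≡1 : C (suc i) ≡ 1) where

    Descends-at Ascends-at : ℕ → Set
    Descends-at t = 1 ≤ t → C t + t ≡ suc m
    Ascends-at t = i < t → C t + i ≡ t

    Descends-upto Ascends-upto : ℕ → Set
    Descends-upto s = ∀ {t} → t ≤ s → Descends-at t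
    Ascends-upto s = ∀ {t} → t ≤ s → Ascends-at t

    descending-ceiling : ∀ {s u} → Descends-upto s → s < u → u ≤ m → C u + s ≤ m
    descending-ceiling {s} {u} descends s<u u≤m = ≮⇒≥ λ m<Cu+s →
      let t = suc m ∸ C u
          Cu+t≡ : C u + t ≡ suc m
          Cu+t≡ = m+[n∸m]≡n (m≤n⇒m≤1+n (C-bounded u≤m))
          t≤s : t ≤ s
          t≤s = +-cancelˡ-≤ (C u) t s (subst (_≤ C u + s) (sym Cu+t≡) m<Cu+s)
          Ct≡Cu : C t ≡ C u
          Ct≡Cu = +-cancelʳ-≡ t (C t) (C u)
                    (trans (descends t≤s (m<n⇒0<n∸m (s≤s (C-bounded u≤m)))) (sym Cu+t≡))
      in <⇒≱ s<u (subst (_≤ s) (C-injective (≤-trans t≤s (<⇒≤ (<-≤-trans s<u u≤m))) u≤m Ct≡Cu) t≤s)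

    descending-large : ∀ {s j} → Descends-upto s → 1 ≤ j → j ≤ s → m < C j + s
    descending-large {s} {j} descends 1≤j j≤s = subst (_≤ C j + s) (descends j≤s 1≤j) (+-monoʳ-≤ (C j) j≤s)

    L-one-below : ∀ {a} → a < suc i → 1 < C a → L 1 < C a
    L-one-below {a} a<ℓ 1<Ca with m≤n⇒m<n∨m≡n i<m
    ... | inj₁ ℓ<m = subst (_< C a) (trans (C-suc ℓ<m) (cong L Cℓ≡1))
                       (C-falls-after a<ℓ (n<1+n (suc i)) ℓ<m (subst (_< C a) (sym Cℓ≡1) 1<Ca))
    ... | inj₂ refl = subst (_< C a) (sym (trans (cong L (sym Cℓ≡1)) L-C-last)) (<-trans z<s 1<Ca)

    large-value-late : ∀ {s j} → Descends-upto s → C (suc s) < C j → C j + s ≡ m → suc s < j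
    large-value-late {s} {j} descends x<Cj Cj+s≡m = ≰⇒> λ j≤s+1 → not-before (m≤n⇒m<n∨m≡n j≤s+1)
      where
      not-before : j < suc s ⊎ j ≡ suc s → ⊥
      not-before (inj₁ j<s+1) =
        <⇒≱ (descending-large descends (position-positive (≤-<-trans z≤n x<Cj)) (s≤s⁻¹ j<s+1))
            (≤-reflexive Cj+s≡m)
      not-before (inj₂ refl) = <-irrefl refl x<Cj

    -- If C (s+1) + s < m, the value m-s sits at a later position j. A 213 would put j before the
    -- position of 1, and then L 1, L (C (s+1)), L (C s) is a 132 at positions 1 < C (s+1) < C s.
    descends-no-gap : ∀ {s} → 1 ≤ s → s < i → Descends-upto s → C (suc s) + s < m → ⊥
    descends-no-gap {s} 1≤s s<i descends x+s<m with C-surjective (m∸n≤m m s)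
    ... | j , j≤m , Cj≡y = compare-with-ℓ (<-cmp j (suc i))
      where
      x y : ℕ
      x = C (suc s)
      y = m ∸ s
      s+1<m : suc s < m
      s+1<m = ≤-trans (s≤s s<i) i<m
      s<m : s < m
      s<m = <⇒≤ s+1<m
      y+s≡m : y + s ≡ m
      y+s≡m = m∸n+n≡m (<⇒≤ s<m)
      x<y : x < y
      x<y = +-cancelʳ-< s x y (subst (x + s <_) (sym y+s≡m) x+s<m)
      x<Cj : x < C j
      x<Cj = subst (x <_) (sym Cj≡y) x<y
      1<x : 1 < x
      1<x = n≢0∧n≢1⇒1<n (>⇒≢ (C-positive (s≤s z≤n) (<⇒≤ s+1<m)))
        (λ x≡1 → <⇒≢ (s≤s s<i) (C-injective (<⇒≤ s+1<m) i<m (trans x≡1 (sym Cℓ≡1))))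
      j-late : suc s < j
      j-late = large-value-late descends x<Cj (trans (cong (_+ s) Cj≡y) y+s≡m)
      x<z : x < C (suc (suc s))
      x<z with m≤n⇒m<n∨m≡n j-late
      ... | inj₁ s+2<j = C-rises-between (n<1+n (suc s)) s+2<j j≤m x<Cj
      ... | inj₂ refl = x<Cj
      x<Cs : x < C s
      x<Cs = +-cancelʳ-< s x (C s) (subst (x + s <_) (sym (descends ≤-refl 1≤s)) (<-trans x+s<m (n<1+n m)))
      compare-with-ℓ : Tri (j < suc i) (j ≡ suc i) (suc i < j) → ⊥
      compare-with-ℓ (tri< _ _ _) = L-avoids-132 1<x x<Cs (C-bounded (<⇒≤ s<m))
        (subst (L 1 <_) (C-suc s<m) (L-one-below (s≤s s<i) 1<x))
        (subst₂ _<_ (C-suc s<m) (C-suc s+1<m) x<z)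
      compare-with-ℓ (tri≈ _ refl _) = <-asym 1<x (subst (x <_) Cℓ≡1 x<Cj)
      compare-with-ℓ (tri> _ _ ℓ<j) = <-asym 1<x (subst (x <_) Cℓ≡1 (C-rises-between (s≤s s<i) ℓ<j j≤m x<Cj))

    descends-step : ∀ {s} → 1 ≤ s → s < i → Descends-upto s → C (suc s) + suc s ≡ suc m
    descends-step {s} 1≤s s<i descends = trans (+-suc (C (suc s)) s)
      (cong suc (≤-antisym (descending-ceiling descends (n<1+n s) (≤-trans s<i (<⇒≤ i<m)))
                           (≮⇒≥ (descends-no-gap 1≤s s<i descends))))

    descends-upto : ∀ {s} → 1 ≤ s → s ≤ i → Descends-upto s
    descends-upto {suc zero} _ _ =
      extend-≤ {Descends-at} (λ t≤0 1≤t → ⊥-elim (<⇒≱ 1≤t t≤0))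
        (λ _ → trans (+-comm (C 1) 1) (cong suc C1≡m))
    descends-upto {suc (suc s)} _ s+1<i =
      let below = descends-upto {suc s} (s≤s z≤n) (<⇒≤ s+1<i)
      in extend-≤ {Descends-at} below (λ _ → descends-step (s≤s z≤n) s+1<i below)

    C-descends : Descends-upto i
    C-descends = descends-upto 1≤i ≤-refl

    -- If C m + i < m, then L (C m) = 0, L (m-i) > 1, L (m+1-i) = 1 is a 132 at positions C m < m-i < m+1-i.
    C-last : C m + i ≡ m
    C-last with m≤n⇒m<n∨m≡n i<m
    ... | inj₂ refl = cong (_+ i) Cℓ≡1
    ... | inj₁ _ = ≤-antisym (descending-ceiling C-descends i<m ≤-refl) (≮⇒≥ no-gap)
      where
      no-gap : C m + i < m → ⊥
      no-gap b+i<m = L-avoids-132 b<k (n<1+n k) k+1≤m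
          (subst₂ _<_ (sym L-C-last) (sym Lk+1≡1) z<s) (subst (_< L k) (sym Lk+1≡1) 1<Lk)
        where
        b k : ℕ
        b = C m
        k = m ∸ i
        k+i≡m : k + i ≡ m
        k+i≡m = m∸n+n≡m (<⇒≤ i<m)
        Ci≡k+1 : C i ≡ suc k
        Ci≡k+1 = +-cancelʳ-≡ i (C i) (suc k) (trans (C-descends ≤-refl 1≤i) (cong suc (sym k+i≡m)))
        k+1≤m : suc k ≤ m
        k+1≤m = subst (_≤ m) Ci≡k+1 (C-bounded (<⇒≤ i<m))
        Lk+1≡1 : L (suc k) ≡ 1
        Lk+1≡1 = trans (cong L (sym Ci≡k+1)) (trans (sym (C-suc i<m)) Cℓ≡1)
        b<k : b < k
        b<k = +-cancelʳ-< i b k (subst (b + i <_) (sym k+i≡m) b+i<m)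
        1<Lk : 1 < L k
        1<Lk = n≢0∧n≢1⇒1<n
          (λ Lk≡0 → <⇒≢ b<k (L-injective (C-bounded ≤-refl) (<⇒≤ k+1≤m) (trans L-C-last (sym Lk≡0))))
          (λ Lk≡1 → <⇒≢ (n<1+n k) (L-injective (<⇒≤ k+1≤m) k+1≤m (trans Lk≡1 (sym Lk+1≡1))))

    ascends-floor : ∀ {s} → s < m → Ascends-upto s → suc s ≤ C (suc s) + i
    ascends-floor {s} s<m ascends = ≮⇒≥ λ x+i<s+1 →
      <⇒≢ x+i<s+1 (C-injective (<⇒≤ (<-≤-trans x+i<s+1 s<m)) s<m
        (+-cancelʳ-≡ i _ _ (ascends (s≤s⁻¹ x+i<s+1) (+-monoˡ-< i (C-positive (s≤s z≤n) s<m)))))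

    small-value-late : ∀ {s j} → i < s → s < m → Ascends-upto s →
      C j < C (suc s) → C j + i ≡ suc s → suc s < j
    small-value-late {s} {j} i<s s<m ascends Cj<x Cj+i≡s+1 =
      ≰⇒> λ j≤s+1 → not-before (m≤n⇒m<n∨m≡n j≤s+1)
      where
      1≤j : 1 ≤ j
      1≤j = position-positive (+-cancelʳ-< i 0 (C j) (subst (i <_) (sym Cj+i≡s+1) (<-trans i<s (n<1+n s))))
      not-before : j < suc s ⊎ j ≡ suc s → ⊥
      not-before (inj₁ j<s+1) with j ≤? i
      ... | yes j≤i = <⇒≱ (descending-large C-descends 1≤j j≤i) (subst (_≤ m) (sym Cj+i≡s+1) s<m)
      ... | no j≰i = <⇒≢ j<s+1 (trans (sym (ascends (s≤s⁻¹ j<s+1) (≰⇒> j≰i))) Cj+i≡s+1)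
      not-before (inj₂ refl) = <-irrefl refl Cj<x

    -- If s+1 < C (s+1) + i, the value s+1-i sits at a later position j < m and C (s+1), C j, C m is a 213.
    ascends-ceiling : ∀ {s} → i < s → s < m → Ascends-upto s → C (suc s) + i ≤ suc s
    ascends-ceiling {s} i<s s<m ascends = ≮⇒≥ λ s+1<x+i →
      let v = suc s ∸ i
          v+i≡s+1 : v + i ≡ suc s
          v+i≡s+1 = m∸n+n≡m (<⇒≤ (<-trans i<s (n<1+n s)))
          v<x : v < C (suc s)
          v<x = +-cancelʳ-< i v (C (suc s)) (subst (_< C (suc s) + i) (sym v+i≡s+1) s+1<x+i)
          j , j≤m , Cj≡v = C-surjective (<⇒≤ (<-≤-trans v<x (C-bounded s<m)))
          Cj<x = subst (_< C (suc s)) (sym Cj≡v) v<x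
          s+1<j = small-value-late i<s s<m ascends Cj<x (trans (cong (_+ i) Cj≡v) v+i≡s+1)
          j<m : j < m
          j<m = ≤∧≢⇒< j≤m λ j≡m → <-irrefl
            (trans (sym v+i≡s+1) (trans (cong (_+ i) (trans (sym Cj≡v) (cong C j≡m))) C-last))
            (subst (suc s <_) j≡m s+1<j)
          x<Cm : C (suc s) < C m
          x<Cm = ≤∧≢⇒<
            (+-cancelʳ-≤ i (C (suc s)) (C m)
              (≤-trans (descending-ceiling C-descends (<-trans i<s (n<1+n s)) s<m) (≤-reflexive (sym C-last))))
            (C-repeat-free (<-≤-trans s+1<j j≤m) ≤-refl)
      in <-asym Cj<x (C-rises-between s+1<j j<m ≤-refl x<Cm)

    ascends-step : ∀ {s} → i < s → s < m → Ascends-upto s → C (suc s) + i ≡ suc s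
    ascends-step i<s s<m ascends = ≤-antisym (ascends-ceiling i<s s<m ascends) (ascends-floor s<m ascends)

    ascends-upto : ∀ {s} → i < s → s ≤ m → Ascends-upto s
    ascends-upto {suc s} i<s+1 s<m with m≤n⇒m<n∨m≡n i<s+1
    ... | inj₂ refl = λ t≤i+1 i<t →
      subst (λ t → C t + i ≡ t) (sym (≤-antisym t≤i+1 i<t)) (cong (_+ i) Cℓ≡1)
    ... | inj₁ i+1<s+1 =
      let below = ascends-upto {s} (s≤s⁻¹ i+1<s+1) (<⇒≤ s<m)
      in extend-≤ {Ascends-at} below (λ _ → ascends-step (s≤s⁻¹ i+1<s+1) s<m below)

    shape : ∀ {t} → t ≤ m → CycleEntry m i t (C t)
    shape {zero} _ = subst (CycleEntry m i 0) (sym C-zero) origin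
    shape {suc t} t<m with suc t ≤? i
    ... | yes t+1≤i = descending (s≤s z≤n) t+1≤i (C-descends t+1≤i (s≤s z≤n))
    ... | no t+1≰i = ascending (≰⇒> t+1≰i) (ascends-upto i<m ≤-refl t<m (≰⇒> t+1≰i))

  CycleShape : Set
  CycleShape = ∃ λ i → i < m × (∀ {t} → t ≤ m → CycleEntry m i t (C t))

  rotation-shape : C m ≡ m → 1 ≤ m → CycleShape
  rotation-shape Cm≡m 1≤m = 0 , 1≤m , entry
    where
    entry : ∀ {t} → t ≤ m → CycleEntry m 0 t (C t)
    entry {zero} _ = subst (CycleEntry m 0 0) (sym C-zero) origin
    entry {suc t} t<m = ascending (s≤s z≤n) (trans (+-identityʳ _) (rotation Cm≡m t<m))

  descent-shape : C 1 ≡ m → 1 < m → CycleShape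
  descent-shape C1≡m 1<m with C-surjective (<⇒≤ 1<m)
  ... | zero , _ , C0≡1 = ⊥-elim (0≢1+n (trans (sym C-zero) C0≡1))
  ... | suc zero , _ , C1≡1 = ⊥-elim (<⇒≢ 1<m (trans (sym C1≡1) C1≡m))
  ... | suc (suc i) , ℓ≤m , Cℓ≡1 = suc i , ℓ≤m , DescentThenAscent.shape (s≤s z≤n) ℓ≤m C1≡m Cℓ≡1

  cycle-shape : 1 ≤ m → CycleShape
  cycle-shape 1≤m with C-surjective (≤-refl {m})
  ... | zero , _ , C0≡m = ⊥-elim (<-irrefl (trans (sym C-zero) C0≡m) 1≤m)
  ... | suc zero , _ , C1≡m with m≤n⇒m<n∨m≡n 1≤m
  ...   | inj₁ 1<m = descent-shape C1≡m 1<m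
  ...   | inj₂ refl = rotation-shape C1≡m ≤-refl
  cycle-shape 1≤m | suc (suc j) , j+2≤m , Cj+2≡m with m≤n⇒m<n∨m≡n j+2≤m
  ...   | inj₁ j+2<m = ⊥-elim (max-not-interior (s≤s z≤n) j+2<m Cj+2≡m)
  ...   | inj₂ refl = rotation-shape Cj+2≡m 1≤m

  L-of-shape : ∀ {i} (i<m : i < m) → (∀ {t} → t ≤ m → CycleEntry m i t (C t)) →
    ∀ {p} → p ≤ m → L p ≡ next m i p
  L-of-shape i<m shape p≤m with C-surjective p≤m
  ... | t , t≤m , refl with m≤n⇒m<n∨m≡n t≤m
  ...   | inj₁ t<m = trans (sym (C-suc t<m))
                       (Candidate.entry-functional i<m (shape t<m) (Candidate.next-entry i<m t<m (shape t≤m)))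
  ...   | inj₂ t≡m = trans (cong (L ∘ C) t≡m) (trans L-C-last (sym (Candidate.last-entry i<m t≡m (shape t≤m))))

  L-is-candidate : 1 ≤ m → ∃ λ i → i < m × (∀ {p} → p ≤ m → L p ≡ next m i p)
  L-is-candidate 1≤m with i , i<m , shape ← cycle-shape 1≤m = i , i<m , L-of-shape i<m shape


-- Reading the Boolean definitions

allWords-cartesianProduct : (n k : ℕ) → allWords n (suc k) ≡ cartesianProductWith V._∷_ (allFin n) (allWords n k)
allWords-cartesianProduct n k = go (allFin n)
  where
  go : ∀ xs → concatMap (λ x → map (x V.∷_) (allWords n k)) xs ≡ cartesianProductWith V._∷_ xs (allWords n k)
  go [] = refl
  go (x ∷ xs) = cong (map (x V.∷_) (allWords n k) ++_) (go xs)

allWords-unique : (n k : ℕ) → Unique (allWords n k)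
allWords-unique n zero = All.[] ∷ []
allWords-unique n (suc k) rewrite allWords-cartesianProduct n k =
  cartesianProductWith⁺ V._∷_ ∷-injective (allFin⁺ n) (allWords-unique n k)

∈-allWords : {n k : ℕ} (w : Vec (Fin n) k) → w ∈ allWords n k
∈-allWords V.[] = here refl
∈-allWords {n} {suc k} (x V.∷ w) rewrite allWords-cartesianProduct n k =
  ∈-cartesianProductWith⁺ V._∷_ (∈-allFin x) (∈-allWords w)

-- Positions beyond the end of the list read as 0.
nth : List ℕ → ℕ → ℕ
nth [] _ = 0
nth (x ∷ xs) zero = x
nth (x ∷ xs) (suc p) = nth xs p

∈-nth : ∀ {xs b} → b < length xs → nth xs b ∈ xs
∈-nth {x ∷ xs} {zero} _ = here refl
∈-nth {x ∷ xs} {suc b} b<len = there (∈-nth (s≤s⁻¹ b<len))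

nth-of-∈ : ∀ {xs x} → x ∈ xs → ∃ λ b → b < length xs × nth xs b ≡ x
nth-of-∈ (here refl) = 0 , z<s , refl
nth-of-∈ (there x∈xs) with b , b<len , eq ← nth-of-∈ x∈xs = suc b , s≤s b<len , eq

∈-subseqs₁⁺ : ∀ w {p} → p < length w → nth w p ∷ [] ∈ subseqs 1 w
∈-subseqs₁⁺ (x ∷ w) {zero} _ = here refl
∈-subseqs₁⁺ (x ∷ w) {suc p} p<len = there (∈-subseqs₁⁺ w (s≤s⁻¹ p<len))

∈-subseqs₂⁺ : ∀ w {p q} → p < q → q < length w → nth w p ∷ nth w q ∷ [] ∈ subseqs 2 w
∈-subseqs₂⁺ (x ∷ w) {zero} {suc q} _ q<len = ∈-++⁺ˡ (∈-map⁺ (x ∷_) (∈-subseqs₁⁺ w (s≤s⁻¹ q<len)))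
∈-subseqs₂⁺ (x ∷ w) {suc p} {suc q} p<q q<len =
  ∈-++⁺ʳ (map (x ∷_) (subseqs 1 w)) (∈-subseqs₂⁺ w (s≤s⁻¹ p<q) (s≤s⁻¹ q<len))

∈-subseqs₃⁺ : ∀ w {p q r} → p < q → q < r → r < length w →
  nth w p ∷ nth w q ∷ nth w r ∷ [] ∈ subseqs 3 w
∈-subseqs₃⁺ (x ∷ w) {zero} {suc q} {suc r} _ q<r r<len =
  ∈-++⁺ˡ (∈-map⁺ (x ∷_) (∈-subseqs₂⁺ w (s≤s⁻¹ q<r) (s≤s⁻¹ r<len)))
∈-subseqs₃⁺ (x ∷ w) {suc p} {suc q} {suc r} p<q q<r r<len =
  ∈-++⁺ʳ (map (x ∷_) (subseqs 2 w)) (∈-subseqs₃⁺ w (s≤s⁻¹ p<q) (s≤s⁻¹ q<r) (s≤s⁻¹ r<len))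

∈-subseqs₁⁻ : ∀ w {u} → u ∈ subseqs 1 w → ∃ λ p → p < length w × u ≡ nth w p ∷ []
∈-subseqs₁⁻ (x ∷ w) (here refl) = 0 , z<s , refl
∈-subseqs₁⁻ (x ∷ w) (there u∈) with p , p<len , refl ← ∈-subseqs₁⁻ w u∈ = suc p , s≤s p<len , refl

∈-subseqs₂⁻ : ∀ w {u} → u ∈ subseqs 2 w →
  ∃ λ p → ∃ λ q → p < q × q < length w × u ≡ nth w p ∷ nth w q ∷ []
∈-subseqs₂⁻ (x ∷ w) u∈ with ∈-++⁻ (map (x ∷_) (subseqs 1 w)) u∈
... | inj₁ u∈head with v , v∈ , refl ← ∈-map⁻ (x ∷_) u∈head
                  with q , q<len , refl ← ∈-subseqs₁⁻ w v∈ = 0 , suc q , z<s , s≤s q<len , refl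
... | inj₂ u∈tail with p , q , p<q , q<len , refl ← ∈-subseqs₂⁻ w u∈tail =
  suc p , suc q , s≤s p<q , s≤s q<len , refl

∈-subseqs₃⁻ : ∀ w {u} → u ∈ subseqs 3 w →
  ∃ λ p → ∃ λ q → ∃ λ r → p < q × q < r × r < length w × u ≡ nth w p ∷ nth w q ∷ nth w r ∷ []
∈-subseqs₃⁻ (x ∷ w) u∈ with ∈-++⁻ (map (x ∷_) (subseqs 2 w)) u∈
... | inj₁ u∈head with v , v∈ , refl ← ∈-map⁻ (x ∷_) u∈head
                  with q , r , q<r , r<len , refl ← ∈-subseqs₂⁻ w v∈ =
  0 , suc q , suc r , z<s , s≤s q<r , s≤s r<len , refl
... | inj₂ u∈tail with p , q , r , p<q , q<r , r<len , refl ← ∈-subseqs₃⁻ w u∈tail =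
  suc p , suc q , suc r , s≤s p<q , s≤s q<r , s≤s r<len , refl

avoids⇔ : ∀ {a b c} (w : List ℕ) → T (avoids (a ∷ b ∷ c ∷ []) w) ⇔
  (∀ {p q r} → p < q → q < r → r < length w →
     ¬ T (sameOrder (nth w p ∷ nth w q ∷ nth w r ∷ []) (a ∷ b ∷ c ∷ [])))
avoids⇔ {a} {b} {c} w = mk⇔ to from
  where
  matches : List ℕ → Bool
  matches u = sameOrder u (a ∷ b ∷ c ∷ [])
  to : T (avoids (a ∷ b ∷ c ∷ []) w) → _
  to none p<q q<r r<len match =
    Equivalence.to T-not none (any⁺ matches (lose (∈-subseqs₃⁺ w p<q q<r r<len) match))
  from : (∀ {p q r} → p < q → q < r → r < length w →
            ¬ T (sameOrder (nth w p ∷ nth w q ∷ nth w r ∷ []) (a ∷ b ∷ c ∷ []))) →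
         T (avoids (a ∷ b ∷ c ∷ []) w)
  from none = Equivalence.from T-not λ found →
    let u , u∈ , match = find (any⁻ matches (subseqs 3 w) found)
        p , q , r , p<q , q<r , r<len , u≡ = ∈-subseqs₃⁻ w u∈
    in none p<q q<r r<len (subst (T ∘ matches) u≡ match)

sameOrder-132⁺ : ∀ {x y z} → x < z → z < y → T (sameOrder (x ∷ y ∷ z ∷ []) (1 ∷ 3 ∷ 2 ∷ []))
sameOrder-132⁺ {x} {y} {z} x<z z<y
  with x <ᵇ y | <ᵇ-reflects-< x y | x <ᵇ z | <ᵇ-reflects-< x z | y <ᵇ z | <ᵇ-reflects-< y z
... | true | _ | true | _ | false | _ = tt
... | false | ofⁿ x≮y | _ | _ | _ | _ = x≮y (<-trans x<z z<y)
... | true | _ | false | ofⁿ x≮z | _ | _ = x≮z x<z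
... | true | _ | true | _ | true | ofʸ y<z = <-asym y<z z<y

sameOrder-132⁻ : ∀ {x y z} → T (sameOrder (x ∷ y ∷ z ∷ []) (1 ∷ 3 ∷ 2 ∷ [])) → x < z × z ≤ y
sameOrder-132⁻ {x} {y} {z} match
  with x <ᵇ y | x <ᵇ z | <ᵇ-reflects-< x z | y <ᵇ z | <ᵇ-reflects-< y z
... | true | true | ofʸ x<z | false | ofⁿ y≮z = x<z , ≮⇒≥ y≮z
... | false | _ | _ | _ | _ = ⊥-elim match
... | true | false | _ | _ | _ = ⊥-elim match
... | true | true | _ | true | _ = ⊥-elim match

sameOrder-213⁺ : ∀ {x y z} → y < x → x < z → T (sameOrder (x ∷ y ∷ z ∷ []) (2 ∷ 1 ∷ 3 ∷ []))
sameOrder-213⁺ {x} {y} {z} y<x x<z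
  with x <ᵇ y | <ᵇ-reflects-< x y | x <ᵇ z | <ᵇ-reflects-< x z | y <ᵇ z | <ᵇ-reflects-< y z
... | false | _ | true | _ | true | _ = tt
... | true | ofʸ x<y | _ | _ | _ | _ = <-asym x<y y<x
... | false | _ | false | ofⁿ x≮z | _ | _ = x≮z x<z
... | false | _ | true | _ | false | ofⁿ y≮z = y≮z (<-trans y<x x<z)

sameOrder-213⁻ : ∀ {x y z} → T (sameOrder (x ∷ y ∷ z ∷ []) (2 ∷ 1 ∷ 3 ∷ [])) → y ≤ x × x < z
sameOrder-213⁻ {x} {y} {z} match
  with x <ᵇ y | <ᵇ-reflects-< x y | x <ᵇ z | <ᵇ-reflects-< x z | y <ᵇ z
... | false | ofⁿ x≮y | true | ofʸ x<z | true = ≮⇒≥ x≮y , x<z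
... | true | _ | _ | _ | _ = ⊥-elim match
... | false | _ | false | _ | _ = ⊥-elim match
... | false | _ | true | _ | false = ⊥-elim match

avoids-132⇔ : ∀ {m} (w : List ℕ) → length w ≡ suc m → Injective≤ m (nth w) →
  T (avoids (1 ∷ 3 ∷ 2 ∷ []) w) ⇔ Avoids-132 m (nth w)
avoids-132⇔ {m} w len≡ injective = mk⇔
  (λ none {p} {q} {r} p<q q<r r≤m Lp<Lr Lr<Lq →
    Equivalence.to (avoids⇔ w) none p<q q<r (subst (_ <_) (sym len≡) (s≤s r≤m)) (sameOrder-132⁺ Lp<Lr Lr<Lq))
  (λ avoid → Equivalence.from (avoids⇔ w) λ {p} {q} {r} p<q q<r r<len match →
    let r≤m = s≤s⁻¹ (subst (_ <_) len≡ r<len)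
        Lp<Lr , Lr≤Lq = sameOrder-132⁻ match
    in avoid p<q q<r r≤m Lp<Lr
         (≤∧≢⇒< Lr≤Lq λ Lr≡Lq → <⇒≢ q<r (sym (injective r≤m (<⇒≤ (<-≤-trans q<r r≤m)) Lr≡Lq))))

avoids-213⇔ : ∀ {m} (w : List ℕ) → length w ≡ suc m → Injective≤ m (nth w) →
  T (avoids (2 ∷ 1 ∷ 3 ∷ []) w) ⇔ Avoids-213 m (nth w)
avoids-213⇔ {m} w len≡ injective = mk⇔
  (λ none {a} {b} {c} a<b b<c c≤m Cb<Ca Ca<Cc →
    Equivalence.to (avoids⇔ w) none a<b b<c (subst (_ <_) (sym len≡) (s≤s c≤m)) (sameOrder-213⁺ Cb<Ca Ca<Cc))
  (λ avoid → Equivalence.from (avoids⇔ w) λ {a} {b} {c} a<b b<c c<len match →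
    let c≤m = s≤s⁻¹ (subst (_ <_) len≡ c<len)
        b≤m = <⇒≤ (<-≤-trans b<c c≤m)
        Cb≤Ca , Ca<Cc = sameOrder-213⁻ match
    in avoid a<b b<c c≤m
         (≤∧≢⇒< Cb≤Ca (λ Cb≡Ca → <⇒≢ a<b (sym (injective b≤m (<⇒≤ (<-≤-trans a<b b≤m)) Cb≡Ca))))
         Ca<Cc)

distinct⁻ : ∀ xs {a b} → T (distinct _≡ᵇ_ xs) → a < b → b < length xs → nth xs a ≢ nth xs b
distinct⁻ (x ∷ xs) {zero} {suc b} d _ b<len x≡ =
  Equivalence.to T-not (All.lookup (all⁺ _ xs (proj₁ (Equivalence.to T-∧ d))) (∈-nth (s≤s⁻¹ b<len)))
    (≡⇒≡ᵇ x (nth xs b) x≡)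
distinct⁻ (x ∷ xs) {suc a} {suc b} d a<b b<len =
  distinct⁻ xs (proj₂ (Equivalence.to (T-∧ {all (λ y → not (x ≡ᵇ y)) xs}) d))
    (s≤s⁻¹ a<b) (s≤s⁻¹ b<len)

distinct⁺ : ∀ xs → (∀ {a b} → a < b → b < length xs → nth xs a ≢ nth xs b) → T (distinct _≡ᵇ_ xs)
distinct⁺ [] _ = tt
distinct⁺ (x ∷ xs) distinct =
  Equivalence.from T-∧ (all⁻ _ (All.tabulate fresh) , distinct⁺ xs λ a<b b<len → distinct (s≤s a<b) (s≤s b<len))
  where
  fresh : ∀ {y} → y ∈ xs → T (not (x ≡ᵇ y))
  fresh y∈ with b , b<len , refl ← nth-of-∈ y∈ =
    Equivalence.from T-not λ x≡ᵇy → distinct z<s (s≤s b<len) (≡ᵇ⇒≡ x _ x≡ᵇy)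

distinct-toℕ : ∀ {n} (xs : List (Fin n)) → distinct _==_ xs ≡ distinct _≡ᵇ_ (map toℕ xs)
distinct-toℕ [] = refl
distinct-toℕ (x ∷ xs) = cong₂ _∧_ (cong and (map-∘ xs)) (distinct-toℕ xs)

oneLineAt cycleAt : ∀ {n} → Vec (Fin n) n → ℕ → ℕ
oneLineAt w = nth (oneLine w)
cycleAt w = nth (cycleNotation w)

nth-toℕ-toList : ∀ {n k} (w : Vec (Fin n) k) (q : Fin k) →
  nth (map toℕ (V.toList w)) (toℕ q) ≡ toℕ (V.lookup w q)
nth-toℕ-toList (x V.∷ w) fzero = refl
nth-toℕ-toList (x V.∷ w) (fsuc q) = nth-toℕ-toList w q

nth-tabulate : ∀ {n} (h : Fin n → ℕ) (q : Fin n) → nth (tabulate h) (toℕ q) ≡ h q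
nth-tabulate h fzero = refl
nth-tabulate h (fsuc q) = nth-tabulate (h ∘ fsuc) q

position : ∀ {m p} → p ≤ m → Fin (suc m)
position p≤m = fromℕ< (s≤s p≤m)

module _ {m : ℕ} (w : Vec (Fin (suc m)) (suc m)) where

  oneLineAt-lookup : ∀ {p} (p≤m : p ≤ m) → oneLineAt w p ≡ toℕ (V.lookup w (position p≤m))
  oneLineAt-lookup {p} p≤m =
    trans (cong (oneLineAt w) (sym (Fin.toℕ-fromℕ< (s≤s p≤m)))) (nth-toℕ-toList w (position p≤m))

  cycleAt-iter : ∀ {t} → t ≤ m → cycleAt w t ≡ toℕ (iter w t fzero)
  cycleAt-iter {t} t≤m = begin
    nth (cycleNotation w) t              ≡⟨ cong (nth (map f (allFin (suc m)))) (sym (Fin.toℕ-fromℕ< (s≤s t≤m))) ⟩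
    nth (map f (allFin (suc m))) (toℕ q) ≡⟨ cong (λ l → nth l (toℕ q)) (map-tabulate (λ k → k) f) ⟩
    nth (tabulate f) (toℕ q)             ≡⟨ nth-tabulate f q ⟩
    f q                                  ≡⟨ cong (λ s → toℕ (iter w s fzero)) (Fin.toℕ-fromℕ< (s≤s t≤m)) ⟩
    toℕ (iter w t fzero)                 ∎
    where
    open ≡-Reasoning
    f : Fin (suc m) → ℕ
    f k = toℕ (iter w (toℕ k) fzero)
    q : Fin (suc m)
    q = position t≤m

  length-oneLine : length (oneLine w) ≡ suc m
  length-oneLine = trans (length-map toℕ (V.toList w)) (length-toList w)

  length-cycleNotation : length (cycleNotation w) ≡ suc m
  length-cycleNotation = trans (length-map _ (allFin (suc m))) (length-tabulate (λ k → k))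

  oneLineAt-bounded : ∀ {p} → p ≤ m → oneLineAt w p ≤ m
  oneLineAt-bounded p≤m = subst (_≤ m) (sym (oneLineAt-lookup p≤m)) (Fin.toℕ≤pred[n] _)

  cycleAt-suc : ∀ {t} → t < m → cycleAt w (suc t) ≡ oneLineAt w (cycleAt w t)
  cycleAt-suc {t} t<m = begin
    cycleAt w (suc t)                      ≡⟨ cycleAt-iter t<m ⟩
    toℕ (V.lookup w (iter w t fzero))      ≡⟨ sym (nth-toℕ-toList w (iter w t fzero)) ⟩
    oneLineAt w (toℕ (iter w t fzero))     ≡⟨ cong (oneLineAt w) (sym (cycleAt-iter (<⇒≤ t<m))) ⟩
    oneLineAt w (cycleAt w t)              ∎
    where open ≡-Reasoning

  isPerm⇔ : T (isPerm w) ⇔ Injective≤ m (oneLineAt w)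
  isPerm⇔ = mk⇔
    (λ perm {p} {q} → <-distinct⇒injective (λ a<b b≤m →
      distinct⁻ (oneLine w) (subst T (distinct-toℕ (V.toList w)) perm) a<b
        (subst (_ <_) (sym length-oneLine) (s≤s b≤m))))
    (λ injective → subst T (sym (distinct-toℕ (V.toList w))) (distinct⁺ (oneLine w) λ a<b b<len La≡Lb →
      let b≤m = s≤s⁻¹ (subst (_ <_) length-oneLine b<len)
      in <⇒≢ a<b (injective (<⇒≤ (<-≤-trans a<b b≤m)) b≤m La≡Lb)))

  isCyclic⇔ : T (isCyclic w) ⇔ (∀ {v} → v ≤ m → ∃ λ t → t ≤ m × cycleAt w t ≡ v)
  isCyclic⇔ = mk⇔ to from
    where
    hit : Fin (suc m) → Fin (suc m) → Bool
    hit j k = iter w (toℕ k) fzero == j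
    reached : Fin (suc m) → Bool
    reached j = any (hit j) (allFin (suc m))
    to : T (isCyclic w) → ∀ {v} → v ≤ m → ∃ λ t → t ≤ m × cycleAt w t ≡ v
    to cyclic {v} v≤m =
      let k , _ , hit-k = find (any⁻ (hit (position v≤m)) (allFin (suc m))
                                (All.lookup (all⁺ reached (allFin (suc m)) cyclic) (∈-allFin (position v≤m))))
      in toℕ k , Fin.toℕ≤pred[n] k ,
         trans (cycleAt-iter (Fin.toℕ≤pred[n] k)) (trans (≡ᵇ⇒≡ _ _ hit-k) (Fin.toℕ-fromℕ< (s≤s v≤m)))
    from : (∀ {v} → v ≤ m → ∃ λ t → t ≤ m × cycleAt w t ≡ v) → T (isCyclic w)
    from surjective = all⁻ reached {allFin (suc m)} (All.tabulate λ {j} _ →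
      let t , t≤m , Ct≡j = surjective (Fin.toℕ≤pred[n] j)
      in any⁺ (hit j) (lose (∈-allFin (position t≤m)) (≡⇒≡ᵇ _ _
           (trans (cong (λ s → toℕ (iter w s fzero)) (Fin.toℕ-fromℕ< (s≤s t≤m)))
                  (trans (sym (cycleAt-iter t≤m)) Ct≡j)))))

inA⇔admissible : ∀ {m} (w : Vec (Fin (suc m)) (suc m)) →
  T (inA (1 ∷ 3 ∷ 2 ∷ []) (2 ∷ 1 ∷ 3 ∷ []) w) ⇔ Admissible m (oneLineAt w) (cycleAt w)
inA⇔admissible {m} w = mk⇔ to from
  where
  cyclic-from : T (isPerm w) → T (isCyclic w) → Cyclic m (oneLineAt w) (cycleAt w)
  cyclic-from perm cyc = record
    { L-bounded    = oneLineAt-bounded w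
    ; L-injective  = Equivalence.to (isPerm⇔ w) perm
    ; C-zero       = refl
    ; C-suc        = cycleAt-suc w
    ; C-surjective = Equivalence.to (isCyclic⇔ w) cyc
    }
  to : T (inA (1 ∷ 3 ∷ 2 ∷ []) (2 ∷ 1 ∷ 3 ∷ []) w) → Admissible m (oneLineAt w) (cycleAt w)
  to inA-w =
    let perm , rest = Equivalence.to (T-∧ {isPerm w}) inA-w
        cyc , avoidances = Equivalence.to (T-∧ {isCyclic w}) rest
        av132 , av213 = Equivalence.to (T-∧ {avoids (1 ∷ 3 ∷ 2 ∷ []) (oneLine w)}) avoidances
        cyc-w = cyclic-from perm cyc
    in record
      { cyclic       = cyc-w
      ; L-avoids-132 = Equivalence.to (avoids-132⇔ (oneLine w) (length-oneLine w) (Cyclic.L-injective cyc-w)) av132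
      ; C-avoids-213 = Equivalence.to
          (avoids-213⇔ (cycleNotation w) (length-cycleNotation w) (CyclicProperties.C-injective cyc-w)) av213
      }
  from : Admissible m (oneLineAt w) (cycleAt w) → T (inA (1 ∷ 3 ∷ 2 ∷ []) (2 ∷ 1 ∷ 3 ∷ []) w)
  from A = Equivalence.from T-∧ (Equivalence.from (isPerm⇔ w) L-injective ,
           Equivalence.from T-∧ (Equivalence.from (isCyclic⇔ w) C-surjective ,
           Equivalence.from T-∧
             (Equivalence.from (avoids-132⇔ (oneLine w) (length-oneLine w) L-injective) L-avoids-132 ,
              Equivalence.from (avoids-213⇔ (cycleNotation w) (length-cycleNotation w) (CyclicProperties.C-injective cyclic))
                C-avoids-213)))
    where
    open Admissible A
    open Cyclic cyclic

-- Counting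

candidate-map : ∀ {m} → Fin m → Fin (suc m) → Fin (suc m)
candidate-map {m} i c = fromℕ< (s≤s (Candidate.next-bounded (Fin.toℕ<n i) (Fin.toℕ≤pred[n] c)))

candidate : ∀ {m} → Fin m → Vec (Fin (suc m)) (suc m)
candidate i = V.tabulate (candidate-map i)

module _ {m : ℕ} (i : Fin m) where
  open Candidate (Fin.toℕ<n i)

  candidate-oneLine : ∀ {p} → p ≤ m → oneLineAt (candidate i) p ≡ next m (toℕ i) p
  candidate-oneLine {p} p≤m = begin
    oneLineAt (candidate i) p                     ≡⟨ oneLineAt-lookup (candidate i) p≤m ⟩
    toℕ (V.lookup (candidate i) (position p≤m))  ≡⟨ cong toℕ (lookup∘tabulate (candidate-map i) (position p≤m)) ⟩
    toℕ (candidate-map i (position p≤m))          ≡⟨ Fin.toℕ-fromℕ< _ ⟩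
    next m (toℕ i) (toℕ (position p≤m))           ≡⟨ cong (next m (toℕ i)) (Fin.toℕ-fromℕ< (s≤s p≤m)) ⟩
    next m (toℕ i) p                              ∎
    where open ≡-Reasoning

  candidate-entry : ∀ {t} → t ≤ m → CycleEntry m (toℕ i) t (cycleAt (candidate i) t)
  candidate-entry {zero} _ = origin
  candidate-entry {suc t} t<m =
    subst (CycleEntry m (toℕ i) (suc t))
      (sym (trans (cycleAt-suc (candidate i) t<m) (candidate-oneLine (entry-bounded (<⇒≤ t<m) previous))))
      (next-entry t<m previous)
    where
    previous : CycleEntry m (toℕ i) t (cycleAt (candidate i) t)
    previous = candidate-entry (<⇒≤ t<m)

  candidate-admissible : Admissible m (oneLineAt (candidate i)) (cycleAt (candidate i))
  candidate-admissible = record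
    { cyclic = record
      { L-bounded    = oneLineAt-bounded (candidate i)
      ; L-injective  = λ p≤m q≤m Lp≡Lq →
          next-injective p≤m q≤m (trans (sym (candidate-oneLine p≤m)) (trans Lp≡Lq (candidate-oneLine q≤m)))
      ; C-zero       = refl
      ; C-suc        = cycleAt-suc (candidate i)
      ; C-surjective = λ v≤m → let t , t≤m , entry = entry-surjective v≤m
                               in t , t≤m , entry-functional (candidate-entry t≤m) entry
      }
    ; L-avoids-132 = λ p<q q<r r≤m Lp<Lr Lr<Lq →
        let q≤m = <⇒≤ (<-≤-trans q<r r≤m)
            p≤m = <⇒≤ (<-≤-trans p<q q≤m)
        in next-avoids-132 p<q q<r r≤m
             (subst₂ _<_ (candidate-oneLine p≤m) (candidate-oneLine r≤m) Lp<Lr)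
             (subst₂ _<_ (candidate-oneLine r≤m) (candidate-oneLine q≤m) Lr<Lq)
    ; C-avoids-213 = λ a<b b<c c≤m →
        let b≤m = <⇒≤ (<-≤-trans b<c c≤m)
        in entries-avoid-213 a<b b<c c≤m (candidate-entry (<⇒≤ (<-≤-trans a<b b≤m))) (candidate-entry b≤m)
             (candidate-entry c≤m)
    }

candidate-injective : ∀ {m} {i j : Fin m} → candidate i ≡ candidate j → i ≡ j
candidate-injective {m} {i} {j} same = Fin.toℕ-injective (+-cancelˡ-≡ (cycleAt (candidate i) m) _ _
  (trans (Candidate.final-entry (Fin.toℕ<n i) refl (candidate-entry i ≤-refl))
         (sym (Candidate.final-entry (Fin.toℕ<n j) refl
                (subst (λ w → CycleEntry m (toℕ j) m (cycleAt w m)) (sym same) (candidate-entry j ≤-refl))))))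

oneLineAt-ext : ∀ {m} {w w′ : Vec (Fin (suc m)) (suc m)} →
  (∀ {p} → p ≤ m → oneLineAt w p ≡ oneLineAt w′ p) → w ≡ w′
oneLineAt-ext {w = w} {w′} same = begin
  w                         ≡⟨ sym (tabulate∘lookup w) ⟩
  V.tabulate (V.lookup w)   ≡⟨ tabulate-cong (λ q → Fin.toℕ-injective (begin
      toℕ (V.lookup w q)    ≡⟨ sym (nth-toℕ-toList w q) ⟩
      oneLineAt w (toℕ q)   ≡⟨ same (Fin.toℕ≤pred[n] q) ⟩
      oneLineAt w′ (toℕ q)  ≡⟨ nth-toℕ-toList w′ q ⟩
      toℕ (V.lookup w′ q)   ∎)) ⟩
  V.tabulate (V.lookup w′)  ≡⟨ tabulate∘lookup w′ ⟩
  w′                        ∎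
  where open ≡-Reasoning

admissible⇒candidate : ∀ {m} → 1 ≤ m → (w : Vec (Fin (suc m)) (suc m)) →
  Admissible m (oneLineAt w) (cycleAt w) → ∃ λ (i : Fin m) → w ≡ candidate i
admissible⇒candidate {m} 1≤m w A with i , i<m , L≡next ← Necessity.L-is-candidate A 1≤m =
  fromℕ< i<m , oneLineAt-ext λ {p} p≤m →
    trans (L≡next p≤m)
          (sym (trans (candidate-oneLine (fromℕ< i<m) p≤m) (cong (λ k → next m k p) (Fin.toℕ-fromℕ< i<m))))

theorem3p8 : (n : ℕ) → 2 ≤ n → a (1 ∷ 3 ∷ 2 ∷ []) (2 ∷ 1 ∷ 3 ∷ []) n ≡ n ∸ 1
theorem3p8 (suc (suc m)) _ =
  length-filterᵇ-enumerated (inA (1 ∷ 3 ∷ 2 ∷ []) (2 ∷ 1 ∷ 3 ∷ [])) (allWords-unique _ _) ∈-allWords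
    candidate candidate-injective
    (λ w inA-w → admissible⇒candidate (s≤s z≤n) w (Equivalence.to (inA⇔admissible w) inA-w))
    (λ i → Equivalence.from (inA⇔admissible (candidate i)) (candidate-admissible i))
theorem3p8 (suc zero) (s≤s ())
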